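{- Let $G$ be a $k$-fixed graph and let $r=|S(G)|$. Then $k\leq 3$ or $k\geq r-1$.
   Context: Graphs are finite, simple, connected, and (standing assumption) have nontrivial automorphism group $\mathrm{Aut}(G)$. For $S\subseteq V(G)$, $\mathrm{stab}(S)=\{g\in \mathrm{Aut}(G): g(v)=v \text{ for all } v\in S\}$; $S$ is a fixing set if $\mathrm{stab}(S)$ is trivial. $\mathrm{fix}(G)$ is the minimum cardinality of a fixing set; $\mathrm{fxd}(G)$ is the minimum $k$ such that every $k$-element subset of $V(G)$ is a fixing set. $G$ is $k$-fixed if $\mathrm{fix}(G)=\mathrm{fxd}(G)=k$. Two vertices $u,v$ are similar if $g(u)=v$ for some $g\in\mathrm{Aut}(G)$; $S(G)$ is the set of vertices of $G$ that are similar to some vertex other than themselves. -}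

module Defs where

open import Data.Nat using (ℕ; _≤_; _<_; _∸_)
open import Data.Fin using (Fin)
open import Data.Fin.Subset using (Subset; _∈_; ∣_∣)
open import Data.Fin.Permutation using (Permutation′; _⟨$⟩ʳ_)
open import Data.Bool using (Bool; true; false)
open import Data.Product using (Σ; ∃; _×_; _,_)
open import Relation.Binary.PropositionalEquality using (_≡_; _≢_)
open import Relation.Nullary using (¬_)
open import Function.Bundles using (_⇔_)

record Graph (n : ℕ) : Set where
  field
    adj   : Fin n → Fin n → Bool
    sym   : ∀ u v → adj u v ≡ adj v u
    irrefl : ∀ v → adj v v ≡ false
open Graph public

data Reach {n : ℕ} (G : Graph n) : Fin n → Fin n → Set where
  here : ∀ {v} → Reach G v v
  step : ∀ {u w v} → adj G u w ≡ true → Reach G w v → Reach G u v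

Connected : ∀ {n} → Graph n → Set
Connected G = ∀ u v → Reach G u v

IsAut : ∀ {n} → Graph n → Permutation′ n → Set
IsAut G σ = ∀ u v → adj G (σ ⟨$⟩ʳ u) (σ ⟨$⟩ʳ v) ≡ adj G u v

IsIdentity : ∀ {n} → Permutation′ n → Set
IsIdentity σ = ∀ v → σ ⟨$⟩ʳ v ≡ v

NontrivialAut : ∀ {n} → Graph n → Set
NontrivialAut G = Σ _ λ σ → IsAut G σ × ¬ IsIdentity σ

IsFixingSet : ∀ {n} → Graph n → Subset n → Set
IsFixingSet G S = ∀ σ → IsAut G σ → (∀ v → v ∈ S → σ ⟨$⟩ʳ v ≡ v) → IsIdentity σ

IsFix : ∀ {n} → Graph n → ℕ → Set
IsFix G k = (Σ _ λ S → IsFixingSet G S × ∣ S ∣ ≡ k)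
          × (∀ S → IsFixingSet G S → k ≤ ∣ S ∣)

AllFixing : ∀ {n} → Graph n → ℕ → Set
AllFixing G j = ∀ S → ∣ S ∣ ≡ j → IsFixingSet G S

IsFxd : ∀ {n} → Graph n → ℕ → Set
IsFxd G k = AllFixing G k × (∀ j → j < k → ¬ AllFixing G j)

KFixed : ∀ {n} → Graph n → ℕ → Set
KFixed G k = IsFix G k × IsFxd G k

-- v ∈ S(G): v is similar to some vertex other than itself.
Moved : ∀ {n} → Graph n → Fin n → Set
Moved G v = Σ _ λ σ → IsAut G σ × (σ ⟨$⟩ʳ v ≢ v)

IsSimilarSet : ∀ {n} → Graph n → Subset n → Set
IsSimilarSet G SG = ∀ v → (v ∈ SG) ⇔ Moved G v

-- Write k = 2 + j. A connected k-fixed graph with j ≥ 1 has at most k + 1 vertices, and r ≤ n. Suppose n ≥ k + 2 and let K be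
-- the pointwise stabiliser of a j-set U, acting on the complement Ω of U. As every k-set is
-- fixing, a nonidentity element of K fixes at most one point of Ω; as no (k − 1)-set is fixing,
-- for s ≠ t in Ω some element of K fixes s and moves t. Such a K is transitive on Ω. Indeed, an
-- element of K is determined by its values at two points of Ω, so counting K through the pairs
-- (g x, g y): if x and y lay in different orbits, of sizes A and B, then |K| ≤ A(a + 1) with
-- a + 1 the length of the K_x-orbit of y, while the nonidentity elements of the stabilisers of
-- the points of either orbit, together with the identity, are pairwise distinct, so
-- |K| ≥ Aa + Bb + 1 with b defined like a. Hence Bb < A and symmetrically Aa < B, impossible
-- as a, b ≥ 1.
-- Taking w ∈ U shows that all vertices other than w are equally adjacent to w, so G is
-- complete, and a transposition then fixes a k-set avoiding its two points.

module Submission where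

open import Defs hiding (sym)
open import Data.Bool using (true)
import Data.Bool as Bool
open import Data.Empty using (⊥; ⊥-elim)
open import Data.Fin using (Fin; zero; suc; _≟_)
open import Data.Fin.Permutation using (Permutation′; _⟨$⟩ʳ_; _⟨$⟩ˡ_; _∘ₚ_; inverseˡ; inverseʳ; _≈_; transpose)
  renaming (id to idₚ; flip to _⁻¹)
open import Data.Fin.Subset using (Subset; inside; outside; _∈_; _∉_; _⊆_; _∪_; ⁅_⁆; ∁; ∣_∣)
open import Data.Fin.Subset.Properties
  using (∪-identityʳ; drop-∷-⊆; out⊆; in⊆in; s⊆s; p⊆q⇒∣p∣≤∣q∣; x∈p∪q⁻; x∈p∪q⁺; p⊆p∪q; q⊆p∪q;
         x∈⁅y⁆⇒x≡y; x∈⁅x⁆; ∣⁅x⁆∣≡1; x∉p⇒x∈∁p; x∈∁p⇒x∉p; ∣∁p∣≡n∸∣p∣; ∉⊥; ∣⊥∣≡0; ∣p∣≤n)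
open import Data.List using (List; []; _∷_; _++_; map; cartesianProduct; allFin; [_])
open import Data.List.Membership.Propositional using () renaming (_∈_ to _∈ₗ_)
open import Data.List.Membership.Propositional.Properties using (∈-map⁻; ∈-allFin; ∈-cartesianProduct⁺)
open import Data.List.Relation.Unary.All using ([])
import Data.List.Relation.Unary.All as All
open import Data.List.Relation.Unary.AllPairs using ([]; _∷_)
open import Data.List.Relation.Unary.Any using (here; there; _─_)
open import Data.List.Relation.Unary.Unique.Propositional using (Unique)
open import Data.List.Relation.Unary.Unique.Propositional.Properties using (++⁺; map⁺; allFin⁺; cartesianProduct⁺)
open import Data.Nat using (ℕ; zero; suc; _+_; _*_; _∸_; _≤_; z≤n; s≤s; _≤?_; >-nonZero)
open import Data.Nat.Properties
  using (≤-refl; ≤-trans; ≤-reflexive; ≤-antisym; ≰⇒>; ≮⇒≥; <⇒≤; 1+n≰n; <-irrefl; m≤n+m; m≤n⇒m≤1+n;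
         m≤m*n; m<m+n; +-suc; +-monoʳ-≤; +-cancelˡ-≤; *-monoʳ-≤; *-distribˡ-+; *-identityʳ; ∸-monoˡ-≤;
         module ≤-Reasoning)
open import Data.Product using (∃; ∃₂; _×_; _,_; proj₁; proj₂)
open import Data.Product.Properties using (,-injectiveˡ; ,-injectiveʳ)
open import Data.Sum using (_⊎_; inj₁; inj₂; [_,_]′)
open import Data.Sum.Properties using (inj₁-injective; inj₂-injective)
open import Data.Unit using (⊤; tt)
open import Data.Vec using ([]; _∷_; here; there)
open import Function using (_∘_)
open import Level using (0ℓ)
open import Relation.Binary.Definitions using (DecidableEquality)
open import Relation.Binary.PropositionalEquality
  using (_≡_; _≢_; refl; sym; trans; cong; cong₂; subst; ≢-sym; module ≡-Reasoning)
open import Relation.Nullary using (¬_; yes; no; ¬¬-excluded-middle)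
open import Relation.Nullary.Decidable using (decidable-stable)
open import Relation.Nullary.Negation using (contradiction; ¬¬-map)
open import Relation.Unary using (Pred; Decidable; _∖_; _⟨×⟩_; _⟨⊎⟩_)
open import Relation.Unary.Properties using (_×?_; _⊎?_; _∩?_; ∁?)

module _ {A : Set} {P : Pred A 0ℓ} (P? : Decidable P) where

  count : List A → ℕ
  count [] = 0
  count (x ∷ xs) with P? x
  ... | yes _ = suc (count xs)
  ... | no _ = count xs

  count-++ : ∀ xs ys → count (xs ++ ys) ≡ count xs + count ys
  count-++ [] ys = refl
  count-++ (x ∷ xs) ys with P? x
  ... | yes _ = cong suc (count-++ xs ys)
  ... | no _ = count-++ xs ys

  ∈⇒1≤count : ∀ {a xs} → a ∈ₗ xs → P a → 1 ≤ count xs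
  ∈⇒1≤count {xs = x ∷ xs} a∈ pa with P? x
  ... | yes _ = s≤s z≤n
  ∈⇒1≤count (here refl) pa | no ¬pa = ⊥-elim (¬pa pa)
  ∈⇒1≤count (there a∈) pa | no _ = ∈⇒1≤count a∈ pa

count-map : ∀ {A B : Set} {P : Pred B 0ℓ} (P? : Decidable P) (f : A → B) xs →
            count P? (map f xs) ≡ count (λ a → P? (f a)) xs
count-map P? f [] = refl
count-map P? f (x ∷ xs) with P? (f x)
... | yes _ = cong suc (count-map P? f xs)
... | no _ = count-map P? f xs

count-⊎ : ∀ {A B : Set} {P : Pred A 0ℓ} {Q : Pred B 0ℓ} (P? : Decidable P) (Q? : Decidable Q) xs ys →
          count (P? ⊎? Q?) (map inj₁ xs ++ map inj₂ ys) ≡ count P? xs + count Q? ys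
count-⊎ P? Q? xs ys = trans (count-++ (P? ⊎? Q?) (map inj₁ xs) (map inj₂ ys))
  (cong₂ _+_ (count-map (P? ⊎? Q?) inj₁ xs) (count-map (P? ⊎? Q?) inj₂ ys))

module _ {A B : Set} {P : Pred A 0ℓ} {Q : Pred B 0ℓ} (P? : Decidable P) (Q? : Decidable Q) where

  private
    row-inside : ∀ {x} → P x → ∀ ys → count (P? ×? Q?) (map (x ,_) ys) ≡ count Q? ys
    row-inside px [] = refl
    row-inside {x} px (y ∷ ys) with P? x | Q? y
    ... | yes _ | yes _ = cong suc (row-inside px ys)
    ... | yes _ | no _ = row-inside px ys
    ... | no ¬px | _ = ⊥-elim (¬px px)

    row-outside : ∀ {x} → ¬ P x → ∀ ys → count (P? ×? Q?) (map (x ,_) ys) ≡ 0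
    row-outside ¬px [] = refl
    row-outside {x} ¬px (y ∷ ys) with P? x
    ... | yes px = ⊥-elim (¬px px)
    ... | no _ = row-outside ¬px ys

  count-cartesianProduct : ∀ xs ys → count (P? ×? Q?) (cartesianProduct xs ys) ≡ count P? xs * count Q? ys
  count-cartesianProduct [] ys = refl
  count-cartesianProduct (x ∷ xs) ys with P? x | count-++ (P? ×? Q?) (map (x ,_) ys) (cartesianProduct xs ys)
  ... | yes px | split = trans split (cong₂ _+_ (row-inside px ys) (count-cartesianProduct xs ys))
  ... | no ¬px | split = trans split (cong₂ _+_ (row-outside ¬px ys) (count-cartesianProduct xs ys))

module _ {B : Set} where

  ∈-─ : ∀ {b c : B} {ys} (b∈ys : b ∈ₗ ys) → c ∈ₗ ys → c ≢ b → c ∈ₗ (ys ─ b∈ys)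
  ∈-─ (here refl) (here refl) c≢b = ⊥-elim (c≢b refl)
  ∈-─ (here refl) (there c∈ys) _ = c∈ys
  ∈-─ (there b∈ys) (here refl) _ = here refl
  ∈-─ (there b∈ys) (there c∈ys) c≢b = there (∈-─ b∈ys c∈ys c≢b)

  count-─ : ∀ {Q : Pred B 0ℓ} (Q? : Decidable Q) {b ys} (b∈ys : b ∈ₗ ys) → Q b →
            count Q? ys ≡ suc (count Q? (ys ─ b∈ys))
  count-─ Q? {ys = y ∷ ys} (here refl) qb with Q? y
  ... | yes _ = refl
  ... | no ¬qb = ⊥-elim (¬qb qb)
  count-─ Q? {ys = y ∷ ys} (there b∈ys) qb with Q? y
  ... | yes _ = cong suc (count-─ Q? b∈ys qb)
  ... | no _ = count-─ Q? b∈ys qb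

module _ {A B : Set} {P : Pred A 0ℓ} {Q : Pred B 0ℓ} (P? : Decidable P) (Q? : Decidable Q)
         (f : ∀ a → P a → B) (f-Q : ∀ a pa → Q (f a pa))
         (f-injective : ∀ {a a′} pa pa′ → f a pa ≡ f a′ pa′ → a ≡ a′) where

  count-≤-injection : ∀ {xs} → Unique xs → ∀ ys → (∀ {a} → a ∈ₗ xs → ∀ pa → f a pa ∈ₗ ys) →
                      count P? xs ≤ count Q? ys
  count-≤-injection {[]} _ ys _ = z≤n
  count-≤-injection {x ∷ xs} (x∉xs ∷ xs!) ys f∈ys with P? x
  ... | no _ = count-≤-injection xs! ys (λ a∈ → f∈ys (there a∈))
  ... | yes px = ≤-trans (s≤s (count-≤-injection xs! (ys ─ fx∈ys) f∈ys─fx))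
                         (≤-reflexive (sym (count-─ Q? fx∈ys (f-Q x px))))
    where
      fx∈ys = f∈ys (here refl) px
      f∈ys─fx : ∀ {a} → a ∈ₗ xs → ∀ pa → f a pa ∈ₗ (ys ─ fx∈ys)
      f∈ys─fx a∈ pa = ∈-─ fx∈ys (f∈ys (there a∈) pa)
                        (λ eq → All.lookup x∉xs a∈ (sym (f-injective pa px eq)))

module _ {A : Set} (_≟_ : DecidableEquality A) {P : Pred A 0ℓ} (P? : Decidable P) where

  count≤count-∖+1 : ∀ {xs} → Unique xs → ∀ q → count P? xs ≤ count (P? ∩? ∁? (_≟ q)) xs + 1
  count≤count-∖+1 {xs} xs! q = ≤-trans (split xs) (+-monoʳ-≤ _ at-most-once)
    where
      split : ∀ xs → count P? xs ≤ count (P? ∩? ∁? (_≟ q)) xs + count (_≟ q) xs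
      split [] = z≤n
      split (x ∷ xs) with P? x | x ≟ q | split xs
      ... | yes _ | yes _ | ih = ≤-trans (s≤s ih) (≤-reflexive (sym (+-suc _ _)))
      ... | yes _ | no _ | ih = s≤s ih
      ... | no _ | yes _ | ih = ≤-trans ih (≤-trans (m≤n⇒m≤1+n ≤-refl) (≤-reflexive (sym (+-suc _ _))))
      ... | no _ | no _ | ih = ih

      at-most-once : count (_≟ q) xs ≤ 1
      at-most-once = count-≤-injection (_≟ q) (λ (_ : ⊤) → yes tt) (λ _ _ → tt) (λ _ _ → tt)
                       (λ a≡q a′≡q _ → trans a≡q (sym a′≡q)) xs! [ tt ] (λ _ _ → here refl)

Unique-⊎ : ∀ {A B : Set} {xs : List A} {ys : List B} → Unique xs → Unique ys →
           Unique (map inj₁ xs ++ map inj₂ ys)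
Unique-⊎ {xs = xs} {ys} xs! ys! = ++⁺ (map⁺ inj₁-injective xs!) (map⁺ inj₂-injective ys!) disjoint
  where
    disjoint : ∀ {v} → ¬ (v ∈ₗ map inj₁ xs × v ∈ₗ map inj₂ ys)
    disjoint (v∈₁ , v∈₂) with ∈-map⁻ inj₁ v∈₁ | ∈-map⁻ inj₂ v∈₂
    ... | _ , _ , refl | _ , _ , ()

pairs : ∀ n → List (Fin n × Fin n)
pairs n = cartesianProduct (allFin n) (allFin n)

pairs! : ∀ n → Unique (pairs n)
pairs! n = cartesianProduct⁺ (allFin⁺ n) (allFin⁺ n)

∈-pairs : ∀ {n} (ab : Fin n × Fin n) → ab ∈ₗ pairs n
∈-pairs (a , b) = ∈-cartesianProduct⁺ (∈-allFin a) (∈-allFin b)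

∣p∪⁅x⁆∣≡1+∣p∣ : ∀ {n} {p : Subset n} {x} → x ∉ p → ∣ p ∪ ⁅ x ⁆ ∣ ≡ suc ∣ p ∣
∣p∪⁅x⁆∣≡1+∣p∣ {p = inside ∷ p} {zero} x∉p = contradiction here x∉p
∣p∪⁅x⁆∣≡1+∣p∣ {p = outside ∷ p} {zero} _ = cong (λ q → suc ∣ q ∣) (∪-identityʳ p)
∣p∪⁅x⁆∣≡1+∣p∣ {p = inside ∷ p} {suc x} x∉p = cong suc (∣p∪⁅x⁆∣≡1+∣p∣ (λ x∈p → x∉p (there x∈p)))
∣p∪⁅x⁆∣≡1+∣p∣ {p = outside ∷ p} {suc x} x∉p = ∣p∪⁅x⁆∣≡1+∣p∣ (λ x∈p → x∉p (there x∈p))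

∉⇒≢ : ∀ {n} {p : Subset n} {x v} → x ∉ p → v ∈ p → v ≢ x
∉⇒≢ {p = p} x∉p v∈p v≡x = x∉p (subst (_∈ p) v≡x v∈p)

two-distinct : ∀ {n} → 2 ≤ n → ∃₂ λ (x y : Fin n) → x ≢ y
two-distinct (s≤s (s≤s _)) = zero , suc zero , λ ()

∉-∪⁅⁆ : ∀ {n} {U : Subset n} {x v} → v ∉ U → v ≢ x → v ∉ U ∪ ⁅ x ⁆
∉-∪⁅⁆ {U = U} {x} v∉U v≢x v∈U∪x = [ v∉U , v≢x ∘ x∈⁅y⁆⇒x≡y x ]′ (x∈p∪q⁻ U ⁅ x ⁆ v∈U∪x)

between : ∀ {n} {r p : Subset n} {j} → r ⊆ p → ∣ r ∣ ≤ j → j ≤ ∣ p ∣ →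
          ∃ λ q → r ⊆ q × q ⊆ p × ∣ q ∣ ≡ j
between {r = []} {[]} _ z≤n z≤n = [] , (λ ()) , (λ ()) , refl
between {r = inside ∷ r} {outside ∷ p} r⊆p _ _ = contradiction (r⊆p here) λ ()
between {r = inside ∷ r} {inside ∷ p} r⊆p (s≤s r≤j) (s≤s j≤p)
  with between (drop-∷-⊆ r⊆p) r≤j j≤p
... | q , r⊆q , q⊆p , ∣q∣≡j = inside ∷ q , in⊆in r⊆q , in⊆in q⊆p , cong suc ∣q∣≡j
between {r = outside ∷ r} {outside ∷ p} r⊆p r≤j j≤p
  with between (drop-∷-⊆ r⊆p) r≤j j≤p
... | q , r⊆q , q⊆p , ∣q∣≡j = outside ∷ q , s⊆s r⊆q , s⊆s q⊆p , ∣q∣≡j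
between {r = outside ∷ r} {inside ∷ p} {j} r⊆p r≤j j≤1+p with j ≤? ∣ p ∣
... | yes j≤p with between (drop-∷-⊆ r⊆p) r≤j j≤p
...   | q , r⊆q , q⊆p , ∣q∣≡j = outside ∷ q , s⊆s r⊆q , out⊆ q⊆p , ∣q∣≡j
between {r = outside ∷ r} {inside ∷ p} {j} r⊆p r≤j j≤1+p | no j≰p
  with between (drop-∷-⊆ r⊆p) (p⊆q⇒∣p∣≤∣q∣ (drop-∷-⊆ r⊆p)) ≤-refl
...   | q , r⊆q , q⊆p , ∣q∣≡∣p∣ =
  inside ∷ q , out⊆ r⊆q , in⊆in q⊆p , trans (cong suc ∣q∣≡∣p∣) (≤-antisym (≰⇒> j≰p) j≤1+p)

∣∁⁅x⁆∪⁅y⁆∣≡n∸2 : ∀ {n} {x y : Fin n} → x ≢ y → ∣ ∁ (⁅ x ⁆ ∪ ⁅ y ⁆) ∣ ≡ n ∸ 2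
∣∁⁅x⁆∪⁅y⁆∣≡n∸2 {n} {x} {y} x≢y = begin
  ∣ ∁ (⁅ x ⁆ ∪ ⁅ y ⁆) ∣  ≡⟨ ∣∁p∣≡n∸∣p∣ (⁅ x ⁆ ∪ ⁅ y ⁆) ⟩
  n ∸ ∣ ⁅ x ⁆ ∪ ⁅ y ⁆ ∣  ≡⟨ cong (n ∸_) (∣p∪⁅x⁆∣≡1+∣p∣ (x≢y ∘ sym ∘ x∈⁅y⁆⇒x≡y x)) ⟩
  n ∸ suc ∣ ⁅ x ⁆ ∣      ≡⟨ cong (λ m → n ∸ suc m) (∣⁅x⁆∣≡1 x) ⟩
  n ∸ 2                  ∎
  where open ≡-Reasoning

⊆∁⁅x⁆∪⁅y⁆ : ∀ {n} {x y : Fin n} {r} → x ∉ r → y ∉ r → r ⊆ ∁ (⁅ x ⁆ ∪ ⁅ y ⁆)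
⊆∁⁅x⁆∪⁅y⁆ {x = x} {y} x∉r y∉r v∈r =
  x∉p⇒x∈∁p ([ ∉⇒≢ x∉r v∈r ∘ x∈⁅y⁆⇒x≡y x , ∉⇒≢ y∉r v∈r ∘ x∈⁅y⁆⇒x≡y y ]′ ∘ x∈p∪q⁻ ⁅ x ⁆ ⁅ y ⁆)

subset-avoiding : ∀ {n} {x y : Fin n} {r m} → x ≢ y → x ∉ r → y ∉ r → ∣ r ∣ ≤ m → 2 + m ≤ n →
                  ∃ λ U → r ⊆ U × x ∉ U × y ∉ U × ∣ U ∣ ≡ m
subset-avoiding {x = x} {y} x≢y x∉r y∉r r≤m (s≤s (s≤s m≤n∸2))
  with between (⊆∁⁅x⁆∪⁅y⁆ x∉r y∉r) r≤m (≤-trans m≤n∸2 (≤-reflexive (sym (∣∁⁅x⁆∪⁅y⁆∣≡n∸2 x≢y))))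
... | U , r⊆U , U⊆∁ , ∣U∣≡m =
  U , r⊆U , (λ x∈U → x∈∁p⇒x∉p (U⊆∁ x∈U) (x∈p∪q⁺ (inj₁ (x∈⁅x⁆ x)))) ,
            (λ y∈U → x∈∁p⇒x∉p (U⊆∁ y∈U) (x∈p∪q⁺ (inj₂ (x∈⁅x⁆ y)))) , ∣U∣≡m

module _ {n : ℕ} where

  ⟨$⟩ʳ-injective : ∀ (g : Permutation′ n) {u v} → g ⟨$⟩ʳ u ≡ g ⟨$⟩ʳ v → u ≡ v
  ⟨$⟩ʳ-injective g {u} {v} eq = trans (sym (inverseˡ g)) (trans (cong (g ⟨$⟩ˡ_) eq) (inverseˡ g))

  conj : Permutation′ n → Permutation′ n → Permutation′ n
  conj c h = c ⁻¹ ∘ₚ h ∘ₚ c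

  conj-⟨$⟩ʳ : ∀ c h v → conj c h ⟨$⟩ʳ (c ⟨$⟩ʳ v) ≡ c ⟨$⟩ʳ (h ⟨$⟩ʳ v)
  conj-⟨$⟩ʳ c h v = cong (λ w → c ⟨$⟩ʳ (h ⟨$⟩ʳ w)) (inverseˡ c)

  conj-injective : ∀ c {h h′} → conj c h ≈ conj c h′ → h ≈ h′
  conj-injective c {h} {h′} eq v =
    ⟨$⟩ʳ-injective c (trans (sym (conj-⟨$⟩ʳ c h v)) (trans (eq (c ⟨$⟩ʳ v)) (conj-⟨$⟩ʳ c h′ v)))

  conj-≉id : ∀ c {h} → ¬ h ≈ idₚ → ¬ conj c h ≈ idₚ
  conj-≉id c {h} h≉id conj≈id =
    h≉id (conj-injective c {h} {idₚ} λ w → trans (conj≈id w) (sym (inverseʳ c)))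

  record IsPermutationGroup (K : Pred (Permutation′ n) 0ℓ) : Set where
    field
      id-closed : K idₚ
      ∘-closed : ∀ {g h} → K g → K h → K (g ∘ₚ h)
      ⁻¹-closed : ∀ {g} → K g → K (g ⁻¹)

    conj-closed : ∀ {c h} → K c → K h → K (conj c h)
    conj-closed kc kh = ∘-closed (⁻¹-closed kc) (∘-closed kh kc)

_Fixes_ : ∀ {n} → Permutation′ n → Subset n → Set
g Fixes U = ∀ v → v ∈ U → g ⟨$⟩ʳ v ≡ v

Fixes-∪⁅⁆ : ∀ {n} {g : Permutation′ n} {U x} → g Fixes U → g ⟨$⟩ʳ x ≡ x → g Fixes (U ∪ ⁅ x ⁆)
Fixes-∪⁅⁆ {U = U} {x} fixes-U gx≡x v v∈U∪x with x∈p∪q⁻ U ⁅ x ⁆ v∈U∪x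
... | inj₁ v∈U = fixes-U v v∈U
... | inj₂ v∈⁅x⁆ rewrite x∈⁅y⁆⇒x≡y x v∈⁅x⁆ = gx≡x

transpose-≡ˡ : ∀ {n} (x y : Fin n) → transpose x y ⟨$⟩ʳ x ≡ y
transpose-≡ˡ x y with x ≟ x
... | yes _ = refl
... | no x≢x = contradiction refl x≢x

transpose-≢ : ∀ {n} {x y v : Fin n} → v ≢ x → v ≢ y → transpose x y ⟨$⟩ʳ v ≡ v
transpose-≢ {x = x} {y} {v} v≢x v≢y with v ≟ x
... | yes v≡x = contradiction v≡x v≢x
... | no _ with v ≟ y
...   | yes v≡y = contradiction v≡y v≢y
...   | no _ = refl

-- A transitivity criterion for permutation groups

¬¬-∀-Fin : ∀ {m} {P : Pred (Fin m) 0ℓ} → (∀ i → ¬ ¬ P i) → ¬ ¬ (∀ i → P i)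
¬¬-∀-Fin {zero} _ k = k λ ()
¬¬-∀-Fin {suc m} {P} h k =
  h zero λ p₀ → ¬¬-∀-Fin {P = λ i → P (suc i)} (λ i → h (suc i)) λ p₊ →
  k λ { zero → p₀ ; (suc i) → p₊ i }

¬¬-decidable : ∀ {m} {P : Pred (Fin m) 0ℓ} → ¬ ¬ Decidable P
¬¬-decidable = ¬¬-∀-Fin λ _ → ¬¬-excluded-middle

¬¬-decidable₂ : ∀ {m} {P : Pred (Fin m × Fin m) 0ℓ} → ¬ ¬ Decidable P
¬¬-decidable₂ {P = P} = ¬¬-map (λ P? → λ (a , b) → P? a b) (¬¬-∀-Fin λ a → ¬¬-decidable {P = λ b → P (a , b)})

no-mutual-orbit-bound : ∀ {A B a b} → 1 ≤ a → 1 ≤ b → B * b + 1 ≤ A → A * a + 1 ≤ B → ⊥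
no-mutual-orbit-bound {A} {B} {a} {b} 1≤a 1≤b Bb<A Aa<B = <-irrefl refl (begin-strict
  A          ≤⟨ m≤m*n A a {{>-nonZero 1≤a}} ⟩
  A * a      <⟨ m<m+n (A * a) (s≤s z≤n) ⟩
  A * a + 1  ≤⟨ Aa<B ⟩
  B          ≤⟨ m≤m*n B b {{>-nonZero 1≤b}} ⟩
  B * b      <⟨ m<m+n (B * b) (s≤s z≤n) ⟩
  B * b + 1  ≤⟨ Bb<A ⟩
  A          ∎)
  where open ≤-Reasoning

module Transitivity {n} {K : Pred (Permutation′ n) 0ℓ} (K-group : IsPermutationGroup K)
  {Ω : Pred (Fin n) 0ℓ} (Ω-invariant : ∀ g {v} → K g → Ω v → Ω (g ⟨$⟩ʳ v))
  (fixes-two⇒≈id : ∀ g {s t} → K g → Ω s → Ω t → s ≢ t →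
                   g ⟨$⟩ʳ s ≡ s → g ⟨$⟩ʳ t ≡ t → g ≈ idₚ) where

  open IsPermutationGroup K-group

  Orbit : Fin n → Pred (Fin n) 0ℓ
  Orbit p t = ∃ λ g → K g × g ⟨$⟩ʳ p ≡ t

  Orbit₂ : Fin n → Fin n → Pred (Fin n × Fin n) 0ℓ
  Orbit₂ p q (a , b) = ∃ λ g → K g × g ⟨$⟩ʳ p ≡ a × g ⟨$⟩ʳ q ≡ b

  StabOrbit : Fin n → Fin n → Pred (Fin n) 0ℓ
  StabOrbit p q z = Orbit₂ p q (p , z)

  Orbit-Ω : ∀ {p t} → Ω p → Orbit p t → Ω t
  Orbit-Ω Ωp (g , kg , gp≡t) = subst Ω gp≡t (Ω-invariant g kg Ωp)

  Orbit-join : ∀ {p q t} → Orbit p t → Orbit q t → Orbit p q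
  Orbit-join (g , kg , gp≡t) (h , kh , hq≡t) =
    g ∘ₚ h ⁻¹ , ∘-closed kg (⁻¹-closed kh) ,
    trans (cong (h ⟨$⟩ˡ_) (trans gp≡t (sym hq≡t))) (inverseˡ h)

  Orbit-sym : ∀ {p q} → Orbit p q → Orbit q p
  Orbit-sym o = Orbit-join (idₚ , id-closed , refl) o

  fixes-one : ∀ {g s t} → K g → ¬ g ≈ idₚ → Ω s → Ω t → g ⟨$⟩ʳ s ≡ s → g ⟨$⟩ʳ t ≡ t → s ≡ t
  fixes-one {g} {s} {t} kg g≉id Ωs Ωt gs≡s gt≡t with s ≟ t
  ... | yes s≡t = s≡t
  ... | no s≢t = contradiction (fixes-two⇒≈id g kg Ωs Ωt s≢t gs≡s gt≡t) g≉id

  ≈-from-two : ∀ {p q g h} → Ω p → Ω q → p ≢ q → K g → K h →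
               g ⟨$⟩ʳ p ≡ h ⟨$⟩ʳ p → g ⟨$⟩ʳ q ≡ h ⟨$⟩ʳ q → g ≈ h
  ≈-from-two {g = g} {h} Ωp Ωq p≢q kg kh gp≡hp gq≡hq v =
    trans (sym (inverseʳ h)) (cong (h ⟨$⟩ʳ_) (h⁻¹g≈id v))
    where
      back : ∀ {u} → g ⟨$⟩ʳ u ≡ h ⟨$⟩ʳ u → (g ∘ₚ h ⁻¹) ⟨$⟩ʳ u ≡ u
      back eq = trans (cong (h ⟨$⟩ˡ_) eq) (inverseˡ h)
      h⁻¹g≈id : g ∘ₚ h ⁻¹ ≈ idₚ
      h⁻¹g≈id = fixes-two⇒≈id (g ∘ₚ h ⁻¹) (∘-closed kg (⁻¹-closed kh)) Ωp Ωq p≢q (back gp≡hp) (back gq≡hq)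

  module Piece {p q} (Ωp : Ω p) (Ωq : Ω q) (p≢q : p ≢ q)
    (Orbit? : Decidable (Orbit p)) (Orbit₂? : Decidable (Orbit₂ p q)) where

    StabOrbit? : Decidable (StabOrbit p q)
    StabOrbit? z = Orbit₂? (p , z)

    -- Unlike a witness taken from a proof of Orbit p t, rep t depends on t alone; shift and
    -- piece are injective only because of this.
    rep : Fin n → Permutation′ n
    rep t with Orbit? t
    ... | yes (c , _) = c
    ... | no _ = idₚ

    rep-spec : ∀ {t} → Orbit p t → K (rep t) × rep t ⟨$⟩ʳ p ≡ t
    rep-spec {t} o with Orbit? t
    ... | yes (_ , kc , cp≡t) = kc , cp≡t
    ... | no ¬o = contradiction o ¬o

    A a N : ℕ
    A = count Orbit? (allFin n)
    a = count (StabOrbit? ∩? ∁? (_≟ q)) (allFin n)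
    N = count Orbit₂? (pairs n)

    Dom : Pred (Fin n × Fin n) 0ℓ
    Dom = Orbit p ⟨×⟩ (StabOrbit p q ∖ (_≡ q))

    Dom? : Decidable Dom
    Dom? = Orbit? ×? (StabOrbit? ∩? ∁? (_≟ q))

    -- piece (t , z) = c h c⁻¹ with c = rep t and h ∈ K_p sending q to z ≠ q: these are the
    -- nonidentity elements of K_t.
    piece : ∀ d → Dom d → Permutation′ n
    piece (t , _) (_ , (h , _) , _) = conj (rep t) h

    piece-∈ : ∀ d pd → K (piece d pd)
    piece-∈ _ (o , (_ , kh , _) , _) = conj-closed (proj₁ (rep-spec o)) kh

    piece-fixes : ∀ d pd → piece d pd ⟨$⟩ʳ proj₁ d ≡ proj₁ d
    piece-fixes (t , _) (o , (h , _ , hp≡p , _) , _) = begin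
      conj c h ⟨$⟩ʳ t                ≡⟨ cong (conj c h ⟨$⟩ʳ_) (sym cp≡t) ⟩
      conj c h ⟨$⟩ʳ (c ⟨$⟩ʳ p)      ≡⟨ conj-⟨$⟩ʳ c h p ⟩
      c ⟨$⟩ʳ (h ⟨$⟩ʳ p)             ≡⟨ cong (c ⟨$⟩ʳ_) hp≡p ⟩
      c ⟨$⟩ʳ p                       ≡⟨ cp≡t ⟩
      t                              ∎
      where
        open ≡-Reasoning
        c = rep t
        cp≡t = proj₂ (rep-spec o)

    piece-≉id : ∀ d pd → ¬ piece d pd ≈ idₚ
    piece-≉id (t , z) (_ , (h , _ , _ , hq≡z) , z≢q) =
      conj-≉id (rep t) {h} λ h≈id → z≢q (trans (sym hq≡z) (h≈id q))

    piece-Ω : ∀ d → Dom d → Ω (proj₁ d)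
    piece-Ω _ (o , _) = Orbit-Ω Ωp o

    piece-injective : ∀ {d d′} pd pd′ → piece d pd ≈ piece d′ pd′ → d ≡ d′
    piece-injective {t , z} {t′ , z′}
                    pd@(_ , (h , _ , _ , hq≡z) , _) pd′@(_ , (h′ , _ , _ , h′q≡z′) , _) eq
      with fixes-one (piece-∈ _ pd) (piece-≉id _ pd) (piece-Ω _ pd) (piece-Ω _ pd′)
             (piece-fixes _ pd) (trans (eq t′) (piece-fixes _ pd′))
    ... | refl = cong (t ,_) (trans (sym hq≡z) (trans (conj-injective (rep t) {h} {h′} eq q) h′q≡z′))

    count-Dom : count Dom? (pairs n) ≡ A * a
    count-Dom = count-cartesianProduct Orbit? (StabOrbit? ∩? ∁? (_≟ q)) (allFin n) (allFin n)

    shift : Fin n × Fin n → Fin n × Fin n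
    shift (t , z) = t , rep t ⁻¹ ⟨$⟩ʳ z

    shift-∈ : ∀ d → Orbit₂ p q d → (Orbit p ⟨×⟩ StabOrbit p q) (shift d)
    shift-∈ (t , z) (g , kg , gp≡t , gq≡z) =
      (g , kg , gp≡t) ,
      (g ∘ₚ c ⁻¹ , ∘-closed kg (⁻¹-closed kc) ,
       trans (cong (c ⟨$⟩ˡ_) (trans gp≡t (sym cp≡t))) (inverseˡ c) , cong (c ⟨$⟩ˡ_) gq≡z)
      where
        c = rep t
        kc = proj₁ (rep-spec (g , kg , gp≡t))
        cp≡t = proj₂ (rep-spec (g , kg , gp≡t))

    shift-injective : ∀ {d d′} → shift d ≡ shift d′ → d ≡ d′
    shift-injective {t , _} eq with ,-injectiveˡ eq
    ... | refl = cong (t ,_) (⟨$⟩ʳ-injective (rep t ⁻¹) (,-injectiveʳ eq))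

    count-Orbit₂≤ : N ≤ A * a + A
    count-Orbit₂≤ = begin
      N                                        ≤⟨ count-≤-injection Orbit₂? (Orbit? ×? StabOrbit?)
                                                    (λ d _ → shift d) shift-∈ (λ _ _ → shift-injective)
                                                    (pairs! n) (pairs n) (λ _ _ → ∈-pairs _) ⟩
      count (Orbit? ×? StabOrbit?) (pairs n)  ≡⟨ count-cartesianProduct Orbit? StabOrbit? (allFin n) (allFin n) ⟩
      A * count StabOrbit? (allFin n)         ≤⟨ *-monoʳ-≤ A (count≤count-∖+1 _≟_ StabOrbit? (allFin⁺ n) q) ⟩
      A * (a + 1)                             ≡⟨ *-distribˡ-+ A a 1 ⟩
      A * a + A * 1                           ≡⟨ cong (A * a +_) (*-identityʳ A) ⟩
      A * a + A                               ∎
      where open ≤-Reasoning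

  module Bounds {p q} (Ωp : Ω p) (Ωq : Ω q) (p≢q : p ≢ q) (p↛q : ¬ Orbit p q)
    (Orbit-p? : Decidable (Orbit p)) (Orbit-q? : Decidable (Orbit q))
    (Orbit₂-pq? : Decidable (Orbit₂ p q)) (Orbit₂-qp? : Decidable (Orbit₂ q p)) where

    module P = Piece Ωp Ωq p≢q Orbit-p? Orbit₂-pq?
    module Q = Piece Ωq Ωp (≢-sym p≢q) Orbit-q? Orbit₂-qp?

    pieces-disjoint : ∀ d e pd pe → ¬ P.piece d pd ≈ Q.piece e pe
    pieces-disjoint d e pd pe eq = p↛q (Orbit-join (proj₁ pd) (subst (Orbit q) (sym d≡e) (proj₁ pe)))
      where
        d≡e : proj₁ d ≡ proj₁ e
        d≡e = fixes-one (P.piece-∈ d pd) (P.piece-≉id d pd) (P.piece-Ω d pd) (Q.piece-Ω e pe)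
                (P.piece-fixes d pd) (trans (eq (proj₁ e)) (Q.piece-fixes e pe))

    Dom : Pred ((Fin n × Fin n) ⊎ ((Fin n × Fin n) ⊎ ⊤)) 0ℓ
    Dom = P.Dom ⟨⊎⟩ (Q.Dom ⟨⊎⟩ λ _ → ⊤)

    Dom? : Decidable Dom
    Dom? = P.Dom? ⊎? (Q.Dom? ⊎? λ _ → yes tt)

    Q-dom : List ((Fin n × Fin n) ⊎ ⊤)
    Q-dom = map inj₁ (pairs n) ++ map inj₂ [ tt ]

    dom : List ((Fin n × Fin n) ⊎ ((Fin n × Fin n) ⊎ ⊤))
    dom = map inj₁ (pairs n) ++ map inj₂ Q-dom

    element : ∀ d → Dom d → Permutation′ n
    element (inj₁ d) pd = P.piece d pd
    element (inj₂ (inj₁ e)) pe = Q.piece e pe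
    element (inj₂ (inj₂ _)) _ = idₚ

    element-∈ : ∀ d pd → K (element d pd)
    element-∈ (inj₁ d) pd = P.piece-∈ d pd
    element-∈ (inj₂ (inj₁ e)) pe = Q.piece-∈ e pe
    element-∈ (inj₂ (inj₂ _)) _ = id-closed

    element-injective : ∀ {d d′} pd pd′ → element d pd ≈ element d′ pd′ → d ≡ d′
    element-injective {inj₁ _} {inj₁ _} pd pd′ eq = cong inj₁ (P.piece-injective pd pd′ eq)
    element-injective {inj₂ (inj₁ _)} {inj₂ (inj₁ _)} pe pe′ eq = cong (inj₂ ∘ inj₁) (Q.piece-injective pe pe′ eq)
    element-injective {inj₂ (inj₂ _)} {inj₂ (inj₂ _)} _ _ _ = refl
    element-injective {inj₁ d} {inj₂ (inj₁ e)} pd pe eq = contradiction eq (pieces-disjoint d e pd pe)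
    element-injective {inj₂ (inj₁ e)} {inj₁ d} pe pd eq = contradiction (λ v → sym (eq v)) (pieces-disjoint d e pd pe)
    element-injective {inj₁ d} {inj₂ (inj₂ _)} pd _ eq = contradiction eq (P.piece-≉id d pd)
    element-injective {inj₂ (inj₂ _)} {inj₁ d} _ pd eq = contradiction (λ v → sym (eq v)) (P.piece-≉id d pd)
    element-injective {inj₂ (inj₁ e)} {inj₂ (inj₂ _)} pe _ eq = contradiction eq (Q.piece-≉id e pe)
    element-injective {inj₂ (inj₂ _)} {inj₂ (inj₁ e)} _ pe eq = contradiction (λ v → sym (eq v)) (Q.piece-≉id e pe)

    count-dom : count Dom? dom ≡ P.A * P.a + (Q.A * Q.a + 1)
    count-dom = begin
      count Dom? dom                                       ≡⟨ count-⊎ P.Dom? _ (pairs n) Q-dom ⟩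
      count P.Dom? (pairs n) + count (Q.Dom? ⊎? _) Q-dom  ≡⟨ cong₂ _+_ P.count-Dom (count-⊎ Q.Dom? _ (pairs n) [ tt ]) ⟩
      P.A * P.a + (count Q.Dom? (pairs n) + 1)             ≡⟨ cong (λ m → P.A * P.a + (m + 1)) Q.count-Dom ⟩
      P.A * P.a + (Q.A * Q.a + 1)                          ∎
      where open ≡-Reasoning

    -- By ≈-from-two, code is injective on K, so P.N counts K.
    code : Permutation′ n → Fin n × Fin n
    code g = g ⟨$⟩ʳ p , g ⟨$⟩ʳ q

    code-injective : ∀ {d d′} pd pd′ → code (element d pd) ≡ code (element d′ pd′) → d ≡ d′
    code-injective {d} {d′} pd pd′ eq = element-injective pd pd′
      (≈-from-two Ωp Ωq p≢q (element-∈ d pd) (element-∈ d′ pd′) (,-injectiveˡ eq) (,-injectiveʳ eq))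

    count-Orbit₂≥ : P.A * P.a + (Q.A * Q.a + 1) ≤ P.N
    count-Orbit₂≥ = ≤-trans (≤-reflexive (sym count-dom))
      (count-≤-injection Dom? Orbit₂-pq? (λ d pd → code (element d pd))
        (λ d pd → element d pd , element-∈ d pd , refl , refl) code-injective
        (Unique-⊎ (pairs! n) (Unique-⊎ (pairs! n) ([] ∷ []))) (pairs n) (λ _ _ → ∈-pairs _))

    orbit-bound : Q.A * Q.a + 1 ≤ P.A
    orbit-bound = +-cancelˡ-≤ (P.A * P.a) _ _ (≤-trans count-Orbit₂≥ P.count-Orbit₂≤)

  -- The orbits are decidable only under ¬¬, which suffices for a negative goal.
  transitive : ∀ {x y} → Ω x → Ω y → x ≢ y →
               (∃ λ g → K g × g ⟨$⟩ʳ x ≡ x × g ⟨$⟩ʳ y ≢ y) →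
               (∃ λ h → K h × h ⟨$⟩ʳ y ≡ y × h ⟨$⟩ʳ x ≢ x) →
               ¬ ¬ Orbit x y
  transitive {x} {y} Ωx Ωy x≢y (g , kg , gx≡x , gy≢y) (h , kh , hy≡y , hx≢x) x↛y =
    ¬¬-decidable λ Orbit-x? → ¬¬-decidable λ Orbit-y? →
    ¬¬-decidable₂ λ Orbit₂-xy? → ¬¬-decidable₂ λ Orbit₂-yx? →
    let module XY = Bounds Ωx Ωy x≢y x↛y Orbit-x? Orbit-y? Orbit₂-xy? Orbit₂-yx?
        module YX = Bounds Ωy Ωx (≢-sym x≢y) (x↛y ∘ Orbit-sym) Orbit-y? Orbit-x? Orbit₂-yx? Orbit₂-xy?
    in no-mutual-orbit-bound
         (∈⇒1≤count _ (∈-allFin (g ⟨$⟩ʳ y)) ((g , kg , gx≡x , refl) , gy≢y))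
         (∈⇒1≤count _ (∈-allFin (h ⟨$⟩ʳ x)) ((h , kh , hy≡y , refl) , hx≢x))
         XY.orbit-bound YX.orbit-bound

module _ {n} (G : Graph n) where

  IsAut-∘ : ∀ {g h} → IsAut G g → IsAut G h → IsAut G (g ∘ₚ h)
  IsAut-∘ {g} aut-g aut-h u v = trans (aut-h (g ⟨$⟩ʳ u) (g ⟨$⟩ʳ v)) (aut-g u v)

  IsAut-⁻¹ : ∀ {g} → IsAut G g → IsAut G (g ⁻¹)
  IsAut-⁻¹ {g} aut-g u v =
    trans (sym (aut-g (g ⟨$⟩ˡ u) (g ⟨$⟩ˡ v))) (cong₂ (adj G) (inverseʳ g) (inverseʳ g))

  Stab : Subset n → Pred (Permutation′ n) 0ℓ
  Stab U g = IsAut G g × g Fixes U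

  Stab-isPermutationGroup : ∀ U → IsPermutationGroup (Stab U)
  Stab-isPermutationGroup U = record
    { id-closed = (λ _ _ → refl) , (λ _ _ → refl)
    ; ∘-closed = λ {g} {h} (aut-g , fixes-g) (aut-h , fixes-h) →
        IsAut-∘ {g} {h} aut-g aut-h , λ v v∈U → trans (cong (h ⟨$⟩ʳ_) (fixes-g v v∈U)) (fixes-h v v∈U)
    ; ⁻¹-closed = λ {g} (aut-g , fixes-g) →
        IsAut-⁻¹ {g} aut-g , λ v v∈U → ⟨$⟩ʳ-injective g (trans (inverseʳ g) (sym (fixes-g v v∈U)))
    }

  Stab-preserves-∉ : ∀ {U} g {v} → Stab U g → v ∉ U → g ⟨$⟩ʳ v ∉ U
  Stab-preserves-∉ {U} g (_ , fixes-g) v∉U gv∈U =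
    v∉U (subst (_∈ U) (⟨$⟩ʳ-injective g (fixes-g _ gv∈U)) gv∈U)

  complete⇒IsAut : (∀ {a b} → a ≢ b → adj G a b ≡ true) → ∀ σ → IsAut G σ
  complete⇒IsAut complete σ a b with a ≟ b
  ... | yes refl = trans (irrefl G _) (sym (irrefl G a))
  ... | no a≢b = trans (complete (a≢b ∘ ⟨$⟩ʳ-injective σ)) (sym (complete a≢b))

  Reach⇒neighbour : ∀ {x y} → Reach G x y → x ≢ y → ∃ λ z → adj G x z ≡ true
  Reach⇒neighbour here x≢x = contradiction refl x≢x
  Reach⇒neighbour (step {w = z} xz _) _ = z , xz

  AdjacencyUniform : Set
  AdjacencyUniform = ∀ {w u v} → w ≢ u → w ≢ v → u ≢ v → adj G w u ≡ adj G w v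

  adjacent-to-all : AdjacencyUniform → ∀ {x z} → adj G x z ≡ true → ∀ {b} → b ≢ x → adj G x b ≡ true
  adjacent-to-all uniform {x} {z} xz {b} b≢x with b ≟ z
  ... | yes refl = xz
  ... | no b≢z = trans (uniform (b≢x ∘ sym) x≢z b≢z) xz
    where
      x≢z : x ≢ z
      x≢z refl = contradiction (trans (sym xz) (irrefl G x)) λ ()

  uniform⇒complete : Connected G → AdjacencyUniform → ∀ {x y} → x ≢ y → ∀ {a b} → a ≢ b → adj G a b ≡ true
  uniform⇒complete conn uniform {x} {y} x≢y {a} {b} a≢b
    with adjacent-to-all uniform (proj₂ (Reach⇒neighbour (conn x y) x≢y)) | a ≟ x | b ≟ x
  ... | x~ | yes refl | _ = x~ (a≢b ∘ sym)
  ... | x~ | no _ | yes refl = trans (Graph.sym G a x) (x~ a≢b)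
  ... | x~ | no a≢x | no b≢x = trans (uniform a≢b a≢x b≢x) (trans (Graph.sym G a x) (x~ a≢x))

-- k-fixed graphs

module KFixedGraph {n} (G : Graph n) {j} (all-fixing : AllFixing G (2 + j))
  (fixing-large : ∀ S → IsFixingSet G S → 2 + j ≤ ∣ S ∣) where

  fixes-two⇒≈id : ∀ {U} → ∣ U ∣ ≡ j → ∀ g {s t} → Stab G U g → s ∉ U → t ∉ U → s ≢ t →
                  g ⟨$⟩ʳ s ≡ s → g ⟨$⟩ʳ t ≡ t → g ≈ idₚ
  fixes-two⇒≈id {U} ∣U∣≡j g {s} {t} (aut-g , fixes-U) s∉U t∉U s≢t gs≡s gt≡t =
    all-fixing ((U ∪ ⁅ s ⁆) ∪ ⁅ t ⁆) size g aut-g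
      (Fixes-∪⁅⁆ {g = g} (Fixes-∪⁅⁆ {g = g} fixes-U gs≡s) gt≡t)
    where
      size : ∣ (U ∪ ⁅ s ⁆) ∪ ⁅ t ⁆ ∣ ≡ 2 + j
      size = trans (∣p∪⁅x⁆∣≡1+∣p∣ (∉-∪⁅⁆ t∉U (s≢t ∘ sym)))
                   (cong suc (trans (∣p∪⁅x⁆∣≡1+∣p∣ s∉U) (cong suc ∣U∣≡j)))

  stabiliser-nontrivial : ∀ {U} → ∣ U ∣ ≡ j → ∀ {s t} → s ∉ U → t ∉ U → s ≢ t →
                          ¬ ¬ (∃ λ g → Stab G U g × g ⟨$⟩ʳ s ≡ s × g ⟨$⟩ʳ t ≢ t)
  stabiliser-nontrivial {U} ∣U∣≡j {s} {t} s∉U t∉U s≢t none =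
    1+n≰n (≤-trans (fixing-large (U ∪ ⁅ s ⁆) fixing)
                   (≤-reflexive (trans (∣p∪⁅x⁆∣≡1+∣p∣ s∉U) (cong suc ∣U∣≡j))))
    where
      fixing : IsFixingSet G (U ∪ ⁅ s ⁆)
      fixing σ aut-σ fixes-σ = fixes-two⇒≈id ∣U∣≡j σ (aut-σ , fixes-U) s∉U t∉U s≢t σs≡s σt≡t
        where
          fixes-U : σ Fixes U
          fixes-U v v∈U = fixes-σ v (p⊆p∪q ⁅ s ⁆ v∈U)
          σs≡s = fixes-σ s (q⊆p∪q U ⁅ s ⁆ (x∈⁅x⁆ s))
          σt≡t = decidable-stable (σ ⟨$⟩ʳ t ≟ t) λ σt≢t → none (σ , (aut-σ , fixes-U) , σs≡s , σt≢t)

  stabiliser-transitive : ∀ {U} → ∣ U ∣ ≡ j → ∀ {u v} → u ∉ U → v ∉ U → u ≢ v →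
                          ¬ ¬ (∃ λ g → Stab G U g × g ⟨$⟩ʳ u ≡ v)
  stabiliser-transitive {U} ∣U∣≡j u∉U v∉U u≢v u↛v =
    stabiliser-nontrivial ∣U∣≡j u∉U v∉U u≢v λ fixes-u →
    stabiliser-nontrivial ∣U∣≡j v∉U u∉U (u≢v ∘ sym) λ fixes-v →
    Transitivity.transitive (Stab-isPermutationGroup G U) {_∉ U} (Stab-preserves-∉ G)
      (fixes-two⇒≈id ∣U∣≡j) u∉U v∉U u≢v fixes-u fixes-v u↛v

  adjacency-uniform : 1 ≤ j → 2 + j ≤ n → AdjacencyUniform G
  adjacency-uniform 1≤j 2+j≤n {w} {u} {v} w≢u w≢v u≢v
    with subset-avoiding u≢v (w≢u ∘ sym ∘ x∈⁅y⁆⇒x≡y w) (w≢v ∘ sym ∘ x∈⁅y⁆⇒x≡y w)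
                          (≤-trans (≤-reflexive (∣⁅x⁆∣≡1 w)) 1≤j) 2+j≤n
  ... | U , ⁅w⁆⊆U , u∉U , v∉U , ∣U∣≡j =
    decidable-stable (adj G w u Bool.≟ adj G w v) λ wu≢wv →
    stabiliser-transitive ∣U∣≡j u∉U v∉U u≢v λ (g , (aut-g , fixes-g) , gu≡v) →
    wu≢wv (begin
      adj G w u                        ≡⟨ sym (aut-g w u) ⟩
      adj G (g ⟨$⟩ʳ w) (g ⟨$⟩ʳ u)    ≡⟨ cong₂ (adj G) (fixes-g w (⁅w⁆⊆U (x∈⁅x⁆ w))) gu≡v ⟩
      adj G w v                        ∎)
    where open ≡-Reasoning

  no-large-order : 1 ≤ j → Connected G → 4 + j ≤ n → ⊥
  no-large-order 1≤j conn 4+j≤n =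
    let x , y , x≢y = two-distinct (≤-trans (s≤s (s≤s z≤n)) 4+j≤n)
        S , _ , x∉S , y∉S , ∣S∣≡2+j =
          subset-avoiding x≢y ∉⊥ ∉⊥ (≤-trans (≤-reflexive (∣⊥∣≡0 n)) z≤n) 4+j≤n
        complete = uniform⇒complete G conn
                     (adjacency-uniform 1≤j (≤-trans (m≤n+m (2 + j) 2) 4+j≤n)) x≢y
        τ-fixes-S : transpose x y Fixes S
        τ-fixes-S v v∈S = transpose-≢ (∉⇒≢ x∉S v∈S) (∉⇒≢ y∉S v∈S)
        τ≈id = all-fixing S ∣S∣≡2+j (transpose x y) (complete⇒IsAut G complete (transpose x y)) τ-fixes-S
    in x≢y (trans (sym (τ≈id x)) (transpose-≡ˡ x y))

  order-bound : 1 ≤ j → Connected G → n ≤ 3 + j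
  order-bound 1≤j conn = ≮⇒≥ (no-large-order 1≤j conn)

k-fixed⇒order-bound : ∀ {n} (G : Graph n) {k} → 3 ≤ k → Connected G → KFixed G k → n ≤ suc k
k-fixed⇒order-bound G {suc (suc j)} (s≤s (s≤s 1≤j)) conn ((_ , fixing-large) , all-fixing , _) =
  KFixedGraph.order-bound G all-fixing fixing-large 1≤j conn

theorem8 : ∀ {n} (G : Graph n) (k : ℕ) (SG : Subset n) →
    Connected G → NontrivialAut G → KFixed G k → IsSimilarSet G SG →
    k ≤ 3 ⊎ ∣ SG ∣ ∸ 1 ≤ k
theorem8 {n} G k SG conn _ k-fixed _ with k ≤? 3
... | yes k≤3 = inj₁ k≤3
... | no k≰3 = inj₂ (begin
  ∣ SG ∣ ∸ 1  ≤⟨ ∸-monoˡ-≤ 1 (∣p∣≤n SG) ⟩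
  n ∸ 1       ≤⟨ ∸-monoˡ-≤ 1 (k-fixed⇒order-bound G (<⇒≤ (≰⇒> k≰3)) conn k-fixed) ⟩
  k           ∎)
  where open ≤-Reasoning
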